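{- Let $\mathcal{G}$ be a finite connected simple $r$-regular graph with a proper edge coloring $c:E\to R$, $|R|=r$ (each vertex lies on exactly one edge of each color), and let $\mathcal{P}_{\mathcal{G}}$ be its colorful poset as defined in the context. Then $\mathcal{P}_{\mathcal{G}}$ is an abstract polytope of rank $r$. Moreover $\mathcal{P}_{\mathcal{G}}$ is simple (all vertex-figures are $(r-1)$-simplices) and its $1$-skeleton (the graph on its $0$-faces whose edges are its $1$-faces) is isomorphic to $\mathcal{G}$. Finally, the facets of $\mathcal{P}_{\mathcal{G}}$ are in one-to-one correspondence with the pairs consisting of a color $b\in R$ and a connected component $\mathcal{H}$ of the graph obtained from $\mathcal{G}$ by deleting all edges of color $b$, and the facet corresponding to $(b,\mathcal{H})$ is isomorphic to the colorful polytope $\mathcal{P}_{\mathcal{H}}$ of rank $r-1$ of the properly $(R\setminus\{b\})$-edge-colored $(r-1)$-regular graph $\mathcal{H}$.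
   Context: For $C\subseteq R$, $v\sim_C w$ means there is an edge path from $v$ to $w$ all of whose edges have colors in $C$. The colorful poset $\mathcal{P}_{\mathcal{G}}$ consists of a least face $F_{ -1}$ of rank $-1$ and, for $j=0,\ldots,r$, faces of rank $j$ given by pairs $(C,v)$ with $|C|=j$, $v\in V$, where $(C,v)=(D,w)$ iff $C=D$ and $v\sim_C w$; the order is $(C,v)\le(D,w)$ iff $C\subseteq D$ and $v\sim_D w$. An abstract polytope of rank $n$ is a poset with a strictly monotone rank function onto $\{ -1,0,\ldots,n\}$, with a least and greatest face, in which every flag (maximal chain) has $n+2$ elements, which is strongly flag-connected (any two flags $\Phi,\Psi$ are joined by a sequence of successively adjacent flags, i.e. differing in exactly one face, all containing $\Phi\cap\Psi$), and satisfies the diamond condition (if $F<G$ with ranks $j-1$ and $j+1$ there are exactly two $j$-faces between them). The vertex-figure at a vertex $F$ is the section $\{H: F\le H\}$; the polytope is simple if all vertex-figures are simplices (Boolean lattices). -}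

module Defs where

open import Data.Nat using (ℕ; zero; suc; _+_; _≤_; _<_)
open import Data.Fin using (Fin; punchOut; _≟_)
open import Data.Fin.Subset using (Subset; _∈_; _⊆_; ∣_∣; ∁; ⁅_⁆) renaming (⊤ to full)
open import Data.Maybe using (Maybe; just; nothing)
open import Data.Product using (Σ; ∃; _×_; _,_; proj₁; proj₂)
open import Data.Sum using (_⊎_)
open import Data.Empty using (⊥)
open import Data.List using (List; length)
open import Data.List.Relation.Unary.Any using (Any)
open import Data.List.Relation.Unary.Linked using (Linked)
open import Data.List.Relation.Binary.Pointwise using (Pointwise)
open import Relation.Nullary using (¬_; yes; no)
open import Relation.Binary.PropositionalEquality using (_≡_; sym)
open import Relation.Binary.Structures using (IsPartialOrder)
open import Function using (_∘_)

-- A (finite, simple) graph on vertex type V with an edge colouring by the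
-- colour set Fin r is given by  edge v w : Maybe (Fin r):
--   nothing  = v and w are not adjacent,
--   just c   = {v,w} is an edge, of colour c.
-- (At most one edge between two vertices: simple.)

record ColoredGraph (V : Set) (r : ℕ) : Set where
  field
    edge : V → V → Maybe (Fin r)
open ColoredGraph public

module _ {V : Set} {r : ℕ} (G : ColoredGraph V r) where

  Symmetric : Set
  Symmetric = ∀ v w → edge G v w ≡ edge G w v

  Loopless : Set
  Loopless = ∀ v → edge G v v ≡ nothing

  ProperColoring : Set
  ProperColoring =
    (∀ v (b : Fin r) → ∃ λ w → edge G v w ≡ just b)
    × (∀ v w w′ (b : Fin r) → edge G v w ≡ just b → edge G v w′ ≡ just b → w ≡ w′)

  Adjacent : V → V → Set
  Adjacent v w = ∃ λ c → edge G v w ≡ just c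

  data _∼[_]_ : V → Subset r → V → Set where
    here  : ∀ {C v} → v ∼[ C ] v
    step  : ∀ {C v u w c} → edge G v u ≡ just c → c ∈ C → u ∼[ C ] w → v ∼[ C ] w

  -- connected (in particular nonempty)
  Connected : Set
  Connected = V × (∀ v w → v ∼[ full ] w)

record RawPoset : Set₁ where
  field
    Carrier : Set
    Eq      : Carrier → Carrier → Set
    Le      : Carrier → Carrier → Set
open RawPoset public

downSet : (P : RawPoset) → Carrier P → RawPoset
downSet P F = record
  { Carrier = Σ (Carrier P) (λ H → Le P H F)
  ; Eq = λ x y → Eq P (proj₁ x) (proj₁ y)
  ; Le = λ x y → Le P (proj₁ x) (proj₁ y) }

upSet : (P : RawPoset) → Carrier P → RawPoset
upSet P F = record
  { Carrier = Σ (Carrier P) (λ H → Le P F H)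
  ; Eq = λ x y → Eq P (proj₁ x) (proj₁ y)
  ; Le = λ x y → Le P (proj₁ x) (proj₁ y) }

-- Boolean lattice of subsets of an m-element set = face lattice of the
-- (m-1)-simplex
booleanLattice : ℕ → RawPoset
booleanLattice m = record { Carrier = Subset m ; Eq = _≡_ ; Le = _⊆_ }

record _≅_ (P Q : RawPoset) : Set where
  field
    to        : Carrier P → Carrier Q
    from      : Carrier Q → Carrier P
    to-cong   : ∀ {x y} → Eq P x y → Eq Q (to x) (to y)
    from-cong : ∀ {x y} → Eq Q x y → Eq P (from x) (from y)
    to-from   : ∀ y → Eq Q (to (from y)) y
    from-to   : ∀ x → Eq P (from (to x)) x
    to-mono   : ∀ {x y} → Le P x y → Le Q (to x) (to y)
    from-mono : ∀ {x y} → Le Q x y → Le P (from x) (from y)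

-- Abstract polytopes.
-- Convention: the rank function ρ is shifted by one, i.e. ρ F = rank F + 1,
-- so ρ takes values in {0,…,n+1} for a polytope of rank n.

module _ (P : RawPoset) where
  private
    A = Carrier P
    _≈ₚ_ = Eq P
    _≤ₚ_ = Le P

  _<ₚ_ : A → A → Set
  x <ₚ y = x ≤ₚ y × ¬ (x ≈ₚ y)

  _∈ₗ_ : A → List A → Set
  x ∈ₗ Φ = Any (x ≈ₚ_) Φ

  IsFlag : List A → Set
  IsFlag Φ = Linked _<ₚ_ Φ
           × (∀ x → (∀ y → y ∈ₗ Φ → (x ≤ₚ y ⊎ y ≤ₚ x)) → x ∈ₗ Φ)

  OneOutside : List A → List A → Set
  OneOutside Φ Ψ = Σ A λ x → x ∈ₗ Φ × ¬ (x ∈ₗ Ψ)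
                     × (∀ y → y ∈ₗ Φ → ¬ (y ∈ₗ Ψ) → y ≈ₚ x)

  AdjacentFlags : List A → List A → Set
  AdjacentFlags Φ Ψ = OneOutside Φ Ψ × OneOutside Ψ Φ

  data FlagPath (K : A → Set) : List A → List A → Set where
    done : ∀ {Φ Ψ} → Pointwise _≈ₚ_ Φ Ψ → FlagPath K Φ Ψ
    step : ∀ {Φ Χ Ψ} → IsFlag Χ → AdjacentFlags Φ Χ
         → (∀ x → K x → x ∈ₗ Χ) → FlagPath K Χ Ψ → FlagPath K Φ Ψ

  record IsAbstractPolytope (n : ℕ) (ρ : A → ℕ) : Set where
    field
      isPartialOrder : IsPartialOrder _≈ₚ_ _≤ₚ_
      rank-cong      : ∀ {x y} → x ≈ₚ y → ρ x ≡ ρ y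
      rank-bounded   : ∀ x → ρ x ≤ suc n
      rank-onto      : ∀ j → j ≤ suc n → ∃ λ x → ρ x ≡ j
      rank-strict    : ∀ {x y} → x <ₚ y → ρ x < ρ y
      least          : ∃ λ F → ∀ G → F ≤ₚ G
      greatest       : ∃ λ F → ∀ G → G ≤ₚ F
      flag-length    : ∀ Φ → IsFlag Φ → length Φ ≡ suc (suc n)
      strongly-flag-connected :
        ∀ Φ Ψ → IsFlag Φ → IsFlag Ψ → FlagPath (λ x → x ∈ₗ Φ × x ∈ₗ Ψ) Φ Ψ
      diamond :
        ∀ F G → F <ₚ G → ρ G ≡ suc (suc (ρ F)) →
        Σ A λ H₁ → Σ A λ H₂ → ¬ (H₁ ≈ₚ H₂)
          × (F <ₚ H₁ × H₁ <ₚ G × ρ H₁ ≡ suc (ρ F))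
          × (F <ₚ H₂ × H₂ <ₚ G × ρ H₂ ≡ suc (ρ F))
          × (∀ H → F <ₚ H → H <ₚ G → ρ H ≡ suc (ρ F) → H ≈ₚ H₁ ⊎ H ≈ₚ H₂)

  Simple : (ρ : A → ℕ) → ℕ → Set
  Simple ρ n = ∀ F → ρ F ≡ 1 → upSet P F ≅ booleanLattice n

record SetoidGraph : Set₁ where
  field
    Vtx  : Set
    _≈ᵥ_ : Vtx → Vtx → Set
    Adj  : Vtx → Vtx → Set
open SetoidGraph public

record GraphIso (X Y : SetoidGraph) : Set where
  field
    to        : Vtx X → Vtx Y
    from      : Vtx Y → Vtx X
    to-cong   : ∀ {x y} → _≈ᵥ_ X x y → _≈ᵥ_ Y (to x) (to y)
    from-cong : ∀ {x y} → _≈ᵥ_ Y x y → _≈ᵥ_ X (from x) (from y)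
    to-from   : ∀ y → _≈ᵥ_ Y (to (from y)) y
    from-to   : ∀ x → _≈ᵥ_ X (from (to x)) x
    adj-to    : ∀ {x y} → Adj X x y → Adj Y (to x) (to y)
    adj-from  : ∀ {x y} → Adj Y x y → Adj X (from x) (from y)

underlyingGraph : ∀ {V r} → ColoredGraph V r → SetoidGraph
underlyingGraph {V} G = record { Vtx = V ; _≈ᵥ_ = _≡_ ; Adj = Adjacent G }

skeleton : (P : RawPoset) → (Carrier P → ℕ) → SetoidGraph
skeleton P ρ = record
  { Vtx  = Σ (Carrier P) (λ F → ρ F ≡ 1)
  ; _≈ᵥ_ = λ x y → Eq P (proj₁ x) (proj₁ y)
  ; Adj  = λ x y → ¬ (Eq P (proj₁ x) (proj₁ y))
                 × (Σ (Carrier P) λ E → ρ E ≡ 2 × Le P (proj₁ x) E × Le P (proj₁ y) E) }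

data Face (V : Set) (r : ℕ) : Set where
  bot  : Face V r
  face : Subset r → V → Face V r

module _ {V : Set} {r : ℕ} (G : ColoredGraph V r) where

  _≈F_ : Face V r → Face V r → Set
  bot ≈F bot = Data.Unit.⊤ where import Data.Unit
  bot ≈F face _ _ = ⊥
  face _ _ ≈F bot = ⊥
  face C v ≈F face D w = C ≡ D × _∼[_]_ G v C w

  _≤F_ : Face V r → Face V r → Set
  bot ≤F _ = Data.Unit.⊤ where import Data.Unit
  face _ _ ≤F bot = ⊥
  face C v ≤F face D w = C ⊆ D × _∼[_]_ G v D w

  colorfulPoset : RawPoset
  colorfulPoset = record { Carrier = Face V r ; Eq = _≈F_ ; Le = _≤F_ }

  rankCP : Face V r → ℕ
  rankCP bot = 0
  rankCP (face C _) = suc ∣ C ∣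

  -- vertices of the component of v in G minus the edges of colour b
  -- (the membership proof is irrelevant, so each vertex occurs once)
  record Component (b : Fin r) (v : V) : Set where
    constructor ⟨_,_⟩
    field
      vertex   : V
      .inComp  : _∼[_]_ G vertex (∁ ⁅ b ⁆) v

  -- pairs (b , H), H a component of G minus colour b, represented by
  -- (b , v) with v ∈ H; two representatives are equal iff they name the
  -- same colour and the same component
  samePair : Fin r × V → Fin r × V → Set
  samePair (b , v) (b′ , w) = b ≡ b′ × _∼[_]_ G v (∁ ⁅ b ⁆) w

  Facet : Set
  Facet = Σ (Face V r) λ F → rankCP F ≡ r

  record FacetBijection : Set where
    field
      to      : Fin r × V → Facet
      to-cong : ∀ {x y} → samePair x y → proj₁ (to x) ≈F proj₁ (to y)
      to-inj  : ∀ {x y} → proj₁ (to x) ≈F proj₁ (to y) → samePair x y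
      to-surj : ∀ (F : Facet) → ∃ λ x → proj₁ (to x) ≈F proj₁ F

-- remove colour b: edges of colour b are deleted, the remaining colours
-- Fin (suc k) ∖ {b} are renumbered to Fin k by punchOut
dropColor : ∀ {k} → Fin (suc k) → Maybe (Fin (suc k)) → Maybe (Fin k)
dropColor b nothing = nothing
dropColor b (just c) with b ≟ c
... | yes _ = nothing
... | no b≢c = just (punchOut b≢c)

componentGraph : ∀ {V r} (G : ColoredGraph V r) (b : Fin r) (v : V)
               → ColoredGraph (Component G b v) (Data.Nat.pred r)
componentGraph {r = suc k} G b v =
  record { edge = λ x y → dropColor b (edge G (Component.vertex x) (Component.vertex y)) }

-- A face (C, v) is determined by the colour set C and the C-component of v, so a flag is a
-- base vertex together with an ordering c₁, …, c_r of the colours (the chain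
-- ∅ ⊂ {c₁} ⊂ {c₁, c₂} ⊂ … of colour sets).  Changing the face of rank 0 moves the base
-- vertex along its c₁-edge; changing the face of rank i > 0 swaps cᵢ and cᵢ₊₁.
-- Strong flag-connectedness follows from an explicit walk between two such flags that
-- never changes a face they share: if j₀ is the least level at which they agree, the base
-- vertex travels to the target one along a path with colours in the common set C_{j₀},
-- each colour first being bubbled down to position 1 (so only levels below j₀ change);
-- then, with equal base vertices, the colour ordering is sorted into the target one from
-- the bottom up, changing only faces that are not in the target flag.
-- Since every vertex lies on exactly one edge of each colour, a face of rank 1 has exactly
-- two vertices (the diamond condition at the bottom and the 1-skeleton), and deleting the
-- colour b from all colour sets identifies the facet (R∖{b}, v) with the colourful poset
-- of the component of v in G minus the edges of colour b.

module Submission where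

open import Defs
open import Data.Bool using (not)
import Data.Bool.Properties as Bool
open import Data.Empty using (⊥-elim)
open import Data.Fin using (Fin; zero; suc; punchIn; punchOut)
import Data.Fin as Fin
import Data.Fin.Properties as Fin
open import Data.Fin.Subset using (Subset; _∈_; _∉_; _⊆_; ∣_∣; ∁; ⁅_⁆; _∪_; inside; outside)
  renaming (⊤ to full; ⊥ to ∅)
open import Data.Fin.Subset.Properties
  using ( _∈?_; ⊆-refl; ⊆-trans; ⊆-antisym; drop-∷-⊆; ⊥⊆; ⊆⊤; ∉⊥; ∈⊤; ∣⊥∣≡0; ∣⊤∣≡n; ∣p∣≡n⇒p≡⊤; ∣p∣≤n
        ; ∣p∣≤∣x∷p∣; p⊆q⇒∣p∣≤∣q∣; x∈⁅x⁆; x∈⁅y⁆⇒x≡y; ∣⁅x⁆∣≡1; x∈∁p⇒x∉p; x∉p⇒x∈∁p; ∣∁p∣≡n∸∣p∣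
        ; x∈p∪q⁻; p⊆p∪q; q⊆p∪q; ∪-identityˡ; ∪-identityʳ )
open import Data.List using (List; []; _∷_; map; iterate; applyUpTo; length)
import Data.List.Properties as List
import Data.List.Membership.Setoid as Membership
import Data.List.Membership.Setoid.Properties as Membershipₚ
import Data.List.Relation.Binary.Equality.Setoid as ListEquality
open import Data.List.Relation.Unary.All using (All; lookupₛ)
import Data.List.Relation.Unary.All as All
open import Data.List.Relation.Unary.Any using (here; there)
import Data.List.Relation.Unary.Any.Properties as Any
open import Data.List.Relation.Unary.Linked using (Linked; []; [-]; _∷_)
import Data.List.Relation.Unary.Linked as Linked
open import Data.List.Relation.Unary.Linked.Properties using (Linked⇒All; applyUpTo⁺₁)
open import Data.Maybe using (just; nothing)
import Data.Maybe.Properties as Maybe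
open import Data.Nat using (ℕ; zero; suc; _+_; _∸_; _≤_; _<_; z≤n; s≤s)
import Data.Nat.Properties as ℕ
open import Data.Product using (Σ; ∃; _×_; _,_; proj₁; proj₂)
open import Data.Sum using (_⊎_; inj₁; inj₂)
open import Data.Unit using (tt)
open import Data.Vec using ([]; _∷_; here; there; tabulate; lookup; removeAt; insertAt)
open import Data.Vec.Properties
  using ( lookup∘tabulate; []=⇒lookup; lookup⇒[]=; ≡-dec; map-∘; map-cong; map-id
        ; removeAt-punchOut; insertAt-punchIn; insertAt-lookup; removeAt-insertAt; insertAt-removeAt )
open import Function using (_∘_)
open import Relation.Binary.Bundles using (Setoid)
open import Relation.Binary.PropositionalEquality
  using (_≡_; _≢_; refl; sym; trans; cong; subst; module ≡-Reasoning)
open import Relation.Binary.Structures using (IsPartialOrder)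
open import Relation.Nullary using (¬_; Dec; yes; no; does)
open import Relation.Nullary.Decidable using (dec-true; _×-dec_; recompute)
open import Relation.Unary using (Pred; Decidable)

private
  variable
    m : ℕ
    p q : Subset m
    x y : Fin m

-- Finite subsets

p⊆q∧∣p∣≡∣q∣⇒p≡q : p ⊆ q → ∣ p ∣ ≡ ∣ q ∣ → p ≡ q
p⊆q∧∣p∣≡∣q∣⇒p≡q {p = []}          {[]}          _   _ = refl
p⊆q∧∣p∣≡∣q∣⇒p≡q {p = inside ∷ p}  {inside ∷ q}  p⊆q e =
  cong (inside ∷_) (p⊆q∧∣p∣≡∣q∣⇒p≡q (drop-∷-⊆ p⊆q) (ℕ.suc-injective e))
p⊆q∧∣p∣≡∣q∣⇒p≡q {p = outside ∷ p} {outside ∷ q} p⊆q e =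
  cong (outside ∷_) (p⊆q∧∣p∣≡∣q∣⇒p≡q (drop-∷-⊆ p⊆q) e)
p⊆q∧∣p∣≡∣q∣⇒p≡q {p = inside ∷ p}  {outside ∷ q} p⊆q _ with () ← p⊆q here
p⊆q∧∣p∣≡∣q∣⇒p≡q {p = outside ∷ p} {inside ∷ q}  p⊆q e =
  ⊥-elim (ℕ.<-irrefl e (s≤s (p⊆q⇒∣p∣≤∣q∣ (drop-∷-⊆ p⊆q))))

p⊆q∧p≢q⇒∣p∣<∣q∣ : p ⊆ q → p ≢ q → ∣ p ∣ < ∣ q ∣
p⊆q∧p≢q⇒∣p∣<∣q∣ p⊆q p≢q =
  ℕ.≤∧≢⇒< (p⊆q⇒∣p∣≤∣q∣ p⊆q) (p≢q ∘ p⊆q∧∣p∣≡∣q∣⇒p≡q p⊆q)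

∣p∣<∣q∣⇒∃[x∈q∖p] : ∣ p ∣ < ∣ q ∣ → ∃ λ x → x ∈ q × x ∉ p
∣p∣<∣q∣⇒∃[x∈q∖p] {p = s ∷ p} {inside ∷ q} lt with s
... | outside = zero , here , λ ()
... | inside  = let x , x∈q , x∉p = ∣p∣<∣q∣⇒∃[x∈q∖p] {p = p} {q} (ℕ.≤-pred lt)
                in suc x , there x∈q , λ { (there x∈p) → x∉p x∈p }
∣p∣<∣q∣⇒∃[x∈q∖p] {p = s ∷ p} {outside ∷ q} lt =
  let x , x∈q , x∉p = ∣p∣<∣q∣⇒∃[x∈q∖p] {p = p} {q} (ℕ.≤-<-trans (∣p∣≤∣x∷p∣ s p) lt)
  in suc x , there x∈q , λ { (there x∈p) → x∉p x∈p }

x∈p∪⁅y⁆⁻ : x ∈ p ∪ ⁅ y ⁆ → x ∈ p ⊎ x ≡ y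
x∈p∪⁅y⁆⁻ {p = p} {y = y} x∈ with x∈p∪q⁻ p ⁅ y ⁆ x∈
... | inj₁ x∈p = inj₁ x∈p
... | inj₂ x∈y = inj₂ (x∈⁅y⁆⇒x≡y y x∈y)

x∈p∪⁅x⁆ : ∀ (p : Subset m) x → x ∈ p ∪ ⁅ x ⁆
x∈p∪⁅x⁆ p x = q⊆p∪q p ⁅ x ⁆ (x∈⁅x⁆ x)

p∪⁅x⁆⊆q : p ⊆ q → x ∈ q → p ∪ ⁅ x ⁆ ⊆ q
p∪⁅x⁆⊆q p⊆q x∈q y∈ with x∈p∪⁅y⁆⁻ y∈
... | inj₁ y∈p  = p⊆q y∈p
... | inj₂ refl = x∈q

∣p∪⁅x⁆∣≡1+∣p∣ : x ∉ p → ∣ p ∪ ⁅ x ⁆ ∣ ≡ suc ∣ p ∣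
∣p∪⁅x⁆∣≡1+∣p∣ {x = zero}  {p = inside ∷ p}  x∉p = ⊥-elim (x∉p here)
∣p∪⁅x⁆∣≡1+∣p∣ {x = zero}  {p = outside ∷ p} _   = cong (suc ∘ ∣_∣) (∪-identityʳ p)
∣p∪⁅x⁆∣≡1+∣p∣ {x = suc x} {p = inside ∷ p}  x∉p = cong suc (∣p∪⁅x⁆∣≡1+∣p∣ (x∉p ∘ there))
∣p∪⁅x⁆∣≡1+∣p∣ {x = suc x} {p = outside ∷ p} x∉p = ∣p∪⁅x⁆∣≡1+∣p∣ (x∉p ∘ there)

p⊆q∧∣q∣≡1+∣p∣⇒q≡p∪⁅x⁆ : p ⊆ q → ∣ q ∣ ≡ suc ∣ p ∣ → ∃ λ x → x ∉ p × q ≡ p ∪ ⁅ x ⁆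
p⊆q∧∣q∣≡1+∣p∣⇒q≡p∪⁅x⁆ {p = p} p⊆q e
  with x , x∈q , x∉p ← ∣p∣<∣q∣⇒∃[x∈q∖p] {p = p} (ℕ.≤-reflexive (sym e)) =
  x , x∉p , sym (p⊆q∧∣p∣≡∣q∣⇒p≡q (p∪⁅x⁆⊆q p⊆q x∈q) (trans (∣p∪⁅x⁆∣≡1+∣p∣ x∉p) (sym e)))

∣p∣≡0⇒p≡∅ : ∣ p ∣ ≡ 0 → p ≡ ∅
∣p∣≡0⇒p≡∅ {m} e = sym (p⊆q∧∣p∣≡∣q∣⇒p≡q ⊥⊆ (trans (∣⊥∣≡0 m) (sym e)))

∣p∣≡1⇒p≡⁅x⁆ : ∣ p ∣ ≡ 1 → ∃ λ x → p ≡ ⁅ x ⁆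
∣p∣≡1⇒p≡⁅x⁆ {m} e with x , _ , p≡ ← p⊆q∧∣q∣≡1+∣p∣⇒q≡p∪⁅x⁆ ⊥⊆ (trans e (cong suc (sym (∣⊥∣≡0 m)))) =
  x , trans p≡ (∪-identityˡ ⁅ x ⁆)

_≟ₛ_ : (p q : Subset m) → Dec (p ≡ q)
_≟ₛ_ = ≡-dec Bool._≟_

∃[∣p∣≡j] : ∀ m j → j ≤ m → ∃ λ (p : Subset m) → ∣ p ∣ ≡ j
∃[∣p∣≡j] m       zero    _         = ∅ , ∣⊥∣≡0 m
∃[∣p∣≡j] (suc m) (suc j) (s≤s j≤m) = let p , e = ∃[∣p∣≡j] m j j≤m in inside ∷ p , cong suc e

module _ {ℓ} {P : Pred (Fin m) ℓ} (P? : Decidable P) where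

  select : Subset m
  select = tabulate (does ∘ P?)

  select⁺ : P x → x ∈ select
  select⁺ {x} Px = lookup⇒[]= x select (trans (lookup∘tabulate _ x) (dec-true (P? x) Px))

  select⁻ : x ∈ select → P x
  select⁻ {x} x∈ with P? x | trans (sym (lookup∘tabulate (does ∘ P?) x)) ([]=⇒lookup x∈)
  ... | yes Px | _ = Px

module _ {m : ℕ} (b : Fin (suc m)) where

  ∈-removeAt⁺ : ∀ {C : Subset (suc m)} {c} → punchIn b c ∈ C → c ∈ removeAt C b
  ∈-removeAt⁺ {C} {c} c∈ = lookup⇒[]= c _ (trans
    (trans (cong (lookup (removeAt C b)) (sym (Fin.punchOut-punchIn b))) (removeAt-punchOut C _))
    ([]=⇒lookup c∈))

  ∈-removeAt⁻ : ∀ {C : Subset (suc m)} {c} → c ∈ removeAt C b → punchIn b c ∈ C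
  ∈-removeAt⁻ {C} {c} c∈ = lookup⇒[]= (punchIn b c) C (trans
    (sym (trans (cong (lookup (removeAt C b)) (sym (Fin.punchOut-punchIn b))) (removeAt-punchOut C _)))
    ([]=⇒lookup c∈))

  ∈-insertAt⁺ : ∀ {D : Subset m} {c} → c ∈ D → punchIn b c ∈ insertAt D b outside
  ∈-insertAt⁺ {D} {c} c∈ =
    lookup⇒[]= (punchIn b c) _ (trans (insertAt-punchIn D b outside c) ([]=⇒lookup c∈))

  ∈-insertAt⁻ : ∀ {D : Subset m} {x} → x ∈ insertAt D b outside → ∃ λ c → punchIn b c ≡ x × c ∈ D
  ∈-insertAt⁻ {D} {x} x∈ with b Fin.≟ x
  ... | yes refl with () ← trans (sym ([]=⇒lookup x∈)) (insertAt-lookup D b outside)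
  ... | no b≢x = punchOut b≢x , Fin.punchIn-punchOut b≢x , lookup⇒[]= _ D (trans
    (sym (trans (cong (lookup (insertAt D b outside)) (sym (Fin.punchIn-punchOut b≢x)))
                (insertAt-punchIn D b outside (punchOut b≢x))))
    ([]=⇒lookup x∈))

-- Decidable predicates on ℕ

module _ {ℓ} {P : Pred ℕ ℓ} (P? : Decidable P) where

  crossing : ∀ {a b} → a ≤ b → ¬ P a → P b → ∃ λ i → a ≤ i × i < b × ¬ P i × P (suc i)
  crossing {b = zero}  z≤n ¬Pa Pb = ⊥-elim (¬Pa Pb)
  crossing {b = suc b} a≤1+b ¬Pa P1+b with ℕ.m≤n⇒m<n∨m≡n a≤1+b
  ... | inj₂ refl = ⊥-elim (¬Pa P1+b)
  ... | inj₁ (s≤s a≤b) with P? b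
  ...   | no ¬Pb = b , a≤b , ℕ.≤-refl , ¬Pb , P1+b
  ...   | yes Pb = let i , a≤i , i<b , rest = crossing a≤b ¬Pa Pb
                   in i , a≤i , ℕ.m<n⇒m<1+n i<b , rest

  Least : ℕ → Set ℓ
  Least i = P i × (∀ {k} → k < i → ¬ P k)

  least : ∀ {n} → P n → ∃ λ i → i ≤ n × Least i
  least {n} Pn = below n (n , ℕ.≤-refl , Pn)
    where
    below : ∀ n → (∃ λ k → k ≤ n × P k) → ∃ λ i → i ≤ n × Least i
    below zero    (.0 , z≤n , P0) = 0 , z≤n , P0 , λ ()
    below (suc n) (k , k≤1+n , Pk) with ℕ.anyUpTo? P? (suc n)
    ... | yes (j , s≤s j≤n , Pj) = let i , i≤n , least-i = below n (j , j≤n , Pj)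
                                   in i , ℕ.m≤n⇒m≤1+n i≤n , least-i
    ... | no none = k , k≤1+n , Pk , λ l<k Pl → none (_ , ℕ.<-≤-trans l<k k≤1+n , Pl)

-- Ranks along the flags of a graded poset

module GradedPoset
  (P : RawPoset) (isPO : IsPartialOrder (Eq P) (Le P))
  (ρ : Carrier P → ℕ) (N : ℕ)
  (ρ-mono : ∀ {x y} → Le P x y → ρ x ≤ ρ y)
  (ρ-strict : ∀ {x y} → _<ₚ_ P x y → ρ x < ρ y)
  (⊥ₚ ⊤ₚ : Carrier P) (⊥ₚ-least : ∀ x → Le P ⊥ₚ x) (⊤ₚ-greatest : ∀ x → Le P x ⊤ₚ)
  (ρ⊥ₚ : ρ ⊥ₚ ≡ 0) (ρ⊤ₚ : ρ ⊤ₚ ≡ N)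
  (interpolate : ∀ {x y} → Le P x y → suc (suc (ρ x)) ≤ ρ y →
                 ∃ λ z → Le P x z × Le P z y × ρ z ≡ suc (ρ x))
  where

  open IsPartialOrder isPO using (module Eq; reflexive; ≤-respʳ-≈) renaming (trans to ≤-trans)
  private
    setoid : Setoid _ _
    setoid = record { isEquivalence = IsPartialOrder.isEquivalence isPO }
    open Membership setoid using (find) renaming (_∈_ to _∈ₚ_)

  ρ-cong : ∀ {x y} → Eq P x y → ρ x ≡ ρ y
  ρ-cong x≈y = ℕ.≤-antisym (ρ-mono (reflexive x≈y)) (ρ-mono (reflexive (Eq.sym x≈y)))

  ρ≤N : ∀ x → ρ x ≤ N
  ρ≤N x = subst (ρ x ≤_) ρ⊤ₚ (ρ-mono (⊤ₚ-greatest x))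

  head≤ : ∀ {y ys} → Linked (_<ₚ_ P) (y ∷ ys) → ∀ {e} → e ∈ₚ y ∷ ys → Le P y e
  head≤ lk = lookupₛ setoid ≤-respʳ-≈ (Linked⇒All ≤-trans (reflexive Eq.refl) (Linked.map proj₁ lk))

  module _ {Φ : List (Carrier P)} (flag : IsFlag P Φ) where
    open ≡-Reasoning

    private
      maximal = proj₂ flag

    Covered : Carrier P → List (Carrier P) → Set
    Covered x rest = ∀ e → e ∈ₚ Φ → Le P e x ⊎ e ∈ₚ rest

    ranks-from : ∀ x rest → Linked (_<ₚ_ P) (x ∷ rest) → Covered x rest →
                 map ρ (x ∷ rest) ≡ iterate suc (ρ x) (suc N ∸ ρ x)
    ranks-from x [] _ cov
      with e , e∈Φ , ⊤≈e ← find (maximal ⊤ₚ (λ y _ → inj₂ (⊤ₚ-greatest y)))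
      with inj₁ e≤x ← cov e e∈Φ
      = sym (cong (iterate suc (ρ x)) (trans (cong (suc N ∸_) ρx≡N) (ℕ.m+n∸n≡m 1 N)))
      where
      ρx≡N : ρ x ≡ N
      ρx≡N = ℕ.≤-antisym (ρ≤N x) (subst (_≤ ρ x) (trans (sym (ρ-cong ⊤≈e)) ρ⊤ₚ) (ρ-mono e≤x))
    ranks-from x (y ∷ rest) (x<y ∷ lk) cov = begin
      ρ x ∷ map ρ (y ∷ rest)                  ≡⟨ cong (ρ x ∷_) (ranks-from y rest lk cov′) ⟩
      ρ x ∷ iterate suc (ρ y) (suc N ∸ ρ y)   ≡⟨ cong (λ k → ρ x ∷ iterate suc k (suc N ∸ k)) ρy≡1+ρx ⟩
      iterate suc (ρ x) (suc (N ∸ ρ x))       ≡⟨ cong (iterate suc (ρ x)) (sym (ℕ.+-∸-assoc 1 (ρ≤N x))) ⟩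
      iterate suc (ρ x) (suc N ∸ ρ x)         ∎
      where
      cov′ : Covered y rest
      cov′ e e∈Φ with cov e e∈Φ
      ... | inj₁ e≤x            = inj₁ (≤-trans e≤x (proj₁ x<y))
      ... | inj₂ (here e≈y)     = inj₁ (reflexive e≈y)
      ... | inj₂ (there e∈rest) = inj₂ e∈rest
      comparable : ∀ {z} → Le P x z → Le P z y → ∀ e → e ∈ₚ Φ → Le P z e ⊎ Le P e z
      comparable x≤z z≤y e e∈Φ with cov e e∈Φ
      ... | inj₁ e≤x = inj₂ (≤-trans e≤x x≤z)
      ... | inj₂ e∈  = inj₁ (≤-trans z≤y (head≤ lk e∈))
      -- an intermediate face z would be comparable with all of Φ, hence in Φ, yet no face of Φ has its rank
      no-gap : ¬ (suc (suc (ρ x)) ≤ ρ y)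
      no-gap gap with z , x≤z , z≤y , ρz ← interpolate (proj₁ x<y) gap
                 with e , e∈Φ , z≈e ← find (maximal z (comparable x≤z z≤y))
                 with ρe ← trans (sym (ρ-cong z≈e)) ρz
                 with cov e e∈Φ
      ... | inj₁ e≤x = ℕ.≤⇒≯ (ρ-mono e≤x) (ℕ.≤-reflexive (sym ρe))
      ... | inj₂ e∈  = ℕ.≤⇒≯ (ℕ.≤-trans (ρ-mono (head≤ lk e∈)) (ℕ.≤-reflexive ρe)) gap
      ρy≡1+ρx : ρ y ≡ suc (ρ x)
      ρy≡1+ρx with ρ y ℕ.≟ suc (ρ x)
      ... | yes eq = eq
      ... | no neq = ⊥-elim (no-gap (ℕ.≤∧≢⇒< (ρ-strict x<y) (neq ∘ sym)))

  flag-ranks : ∀ {Φ} → IsFlag P Φ → map ρ Φ ≡ iterate suc 0 (suc N)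
  flag-ranks {[]} (_ , maximal) with () ← maximal ⊥ₚ (λ y ())
  flag-ranks {h ∷ rest} flag@(lk , maximal) =
    trans (ranks-from flag h rest lk covered) (cong (λ k → iterate suc k (suc N ∸ k)) ρh≡0)
    where
    covered : Covered flag h rest
    covered e (here e≈h)     = inj₁ (reflexive e≈h)
    covered e (there e∈rest) = inj₂ e∈rest
    ρh≡0 : ρ h ≡ 0
    ρh≡0 = ℕ.n≤0⇒n≡0 (subst (ρ h ≤_) ρ⊥ₚ (ρ-mono (head≤ lk (maximal ⊥ₚ (λ y _ → inj₁ (⊥ₚ-least y))))))

-- Paths in edge-coloured graphs

module Paths {V : Set} {r : ℕ} (G : ColoredGraph V r) where

  infix 4 _∼⟨_⟩_
  _∼⟨_⟩_ : V → Subset r → V → Set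
  _∼⟨_⟩_ = _∼[_]_ G

  ∼-trans : ∀ {C u v w} → u ∼⟨ C ⟩ v → v ∼⟨ C ⟩ w → u ∼⟨ C ⟩ w
  ∼-trans here          q = q
  ∼-trans (step e c∈ p) q = step e c∈ (∼-trans p q)

  ∼-snoc : ∀ {C u v w c} → u ∼⟨ C ⟩ v → edge G v w ≡ just c → c ∈ C → u ∼⟨ C ⟩ w
  ∼-snoc p e c∈ = ∼-trans p (step e c∈ here)

  ∼-mono : ∀ {C D v w} → C ⊆ D → v ∼⟨ C ⟩ w → v ∼⟨ D ⟩ w
  ∼-mono C⊆D here          = here
  ∼-mono C⊆D (step e c∈ p) = step e (C⊆D c∈) (∼-mono C⊆D p)

  ∼⟨∅⟩⇒≡ : ∀ {v w} → v ∼⟨ ∅ ⟩ w → v ≡ w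
  ∼⟨∅⟩⇒≡ here          = refl
  ∼⟨∅⟩⇒≡ (step _ c∈ _) = ⊥-elim (∉⊥ c∈)

  module _ (symmetric : Symmetric G) where

    edge-sym : ∀ {v w c} → edge G v w ≡ just c → edge G w v ≡ just c
    edge-sym {v} {w} e = trans (symmetric w v) e

    ∼-sym : ∀ {C v w} → v ∼⟨ C ⟩ w → w ∼⟨ C ⟩ v
    ∼-sym here          = here
    ∼-sym (step e c∈ p) = ∼-snoc (∼-sym p) (edge-sym e) c∈

module Reachability {n r : ℕ} (G : ColoredGraph (Fin n) r) where
  open Paths G

  Step : Subset r → Fin n → Fin n → Set
  Step C x y = ∃ λ c → edge G x y ≡ just c × c ∈ C

  step? : ∀ C x y → Dec (Step C x y)
  step? C x y with edge G x y
  ... | nothing = no λ ()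
  ... | just c with c ∈? C
  ...   | yes c∈ = yes (c , refl , c∈)
  ...   | no c∉  = no λ { (c′ , e , c′∈) → c∉ (subst (_∈ C) (sym (Maybe.just-injective e)) c′∈) }

  Neighbour : Subset r → Subset n → Fin n → Set
  Neighbour C S y = ∃ λ x → x ∈ S × Step C x y

  neighbour? : ∀ C S → Decidable (Neighbour C S)
  neighbour? C S y = Fin.any? λ x → x ∈? S ×-dec step? C x y

  grow : Subset r → Subset n → Subset n
  grow C S = S ∪ select (neighbour? C S)

  record ReachClosed (C : Subset r) (w : Fin n) (S : Subset n) : Set where
    field
      start  : w ∈ S
      sound  : ∀ {x} → x ∈ S → w ∼⟨ C ⟩ x
      closed : ∀ {x y} → x ∈ S → Step C x y → y ∈ S

    complete : ∀ {x y} → x ∈ S → x ∼⟨ C ⟩ y → y ∈ S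
    complete x∈S here          = x∈S
    complete x∈S (step e c∈ p) = complete (closed x∈S (_ , e , c∈)) p

  -- grow S until it is stable; each strict growth step enlarges ∣ S ∣, which bounds the steps by k
  saturate : ∀ C w k S → n ≤ k + ∣ S ∣ → w ∈ S → (∀ {x} → x ∈ S → w ∼⟨ C ⟩ x) →
             Σ (Subset n) (ReachClosed C w)
  saturate C w k S n≤k+∣S∣ w∈S sound with grow C S ≟ₛ S
  ... | yes fixed = S , record
    { start = w∈S ; sound = sound
    ; closed = λ {x} {y} x∈S st → subst (y ∈_) fixed
        (q⊆p∪q S _ (select⁺ (neighbour? C S) (x , x∈S , st))) }
  ... | no grew with k | p⊆q∧p≢q⇒∣p∣<∣q∣ (p⊆p∪q {p = S} _) (grew ∘ sym)
  ...   | zero  | ∣S∣<∣S′∣ = ⊥-elim (ℕ.<-irrefl refl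
                               (ℕ.<-≤-trans ∣S∣<∣S′∣ (ℕ.≤-trans (∣p∣≤n (grow C S)) n≤k+∣S∣)))
  ...   | suc k | ∣S∣<∣S′∣ = saturate C w k (grow C S)
                               (ℕ.≤-trans n≤k+∣S∣ (subst (_≤ k + ∣ grow C S ∣) (ℕ.+-suc k ∣ S ∣)
                                 (ℕ.+-monoʳ-≤ k ∣S∣<∣S′∣)))
                               (p⊆p∪q _ w∈S) sound′
    where
    sound′ : ∀ {y} → y ∈ grow C S → w ∼⟨ C ⟩ y
    sound′ {y} y∈ with x∈p∪q⁻ S _ y∈
    ... | inj₁ y∈S = sound y∈S
    ... | inj₂ y∈new with x , x∈S , c , e , c∈ ← select⁻ (neighbour? C S) y∈new = ∼-snoc (sound x∈S) e c∈

  reach? : ∀ C v w → Dec (v ∼⟨ C ⟩ w)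
  reach? C v w with S , closedS ← saturate C v n ⁅ v ⁆ (ℕ.m≤m+n n _) (x∈⁅x⁆ v)
                      (λ x∈ → subst (v ∼⟨ C ⟩_) (sym (x∈⁅y⁆⇒x≡y v x∈)) here)
               with w ∈? S
  ... | yes w∈S = yes (ReachClosed.sound closedS w∈S)
  ... | no  w∉S = no (w∉S ∘ ReachClosed.complete closedS (ReachClosed.start closedS))

-- The colourful poset

module ColorfulPoset {V : Set} {r : ℕ} (G : ColoredGraph V r) where
  open Paths G

  infix 4 _≈ᶠ_ _≤ᶠ_ _<ᶠ_
  _≈ᶠ_ _≤ᶠ_ _<ᶠ_ : Face V r → Face V r → Set
  _≈ᶠ_ = _≈F_ G
  _≤ᶠ_ = _≤F_ G
  _<ᶠ_ = _<ₚ_ (colorfulPoset G)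

  ρ : Face V r → ℕ
  ρ = rankCP G

  ≈-refl : ∀ {x} → x ≈ᶠ x
  ≈-refl {bot}       = _
  ≈-refl {face C v} = refl , here

  ≈-trans : ∀ {x y z} → x ≈ᶠ y → y ≈ᶠ z → x ≈ᶠ z
  ≈-trans {bot}      {bot}      {bot}      _          _          = _
  ≈-trans {face _ _} {face _ _} {face _ _} (refl , p) (refl , q) = refl , ∼-trans p q

  ≤-reflexive : ∀ {x y} → x ≈ᶠ y → x ≤ᶠ y
  ≤-reflexive {bot}      {bot}      _          = _
  ≤-reflexive {face _ _} {face _ _} (refl , p) = ⊆-refl , p

  ≤-trans : ∀ {x y z} → x ≤ᶠ y → y ≤ᶠ z → x ≤ᶠ z
  ≤-trans {bot}                                  _         _         = _
  ≤-trans {face _ _} {face _ _} {face _ _} (C⊆D , p) (D⊆E , q) = ⊆-trans C⊆D D⊆E , ∼-trans (∼-mono D⊆E p) q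

  ≤-antisym : ∀ {x y} → x ≤ᶠ y → y ≤ᶠ x → x ≈ᶠ y
  ≤-antisym {bot}      {bot}      _         _         = _
  ≤-antisym {face _ _} {face _ _} (C⊆D , p) (D⊆C , _) with refl ← ⊆-antisym C⊆D D⊆C = refl , p

  ρ-cong : ∀ {x y} → x ≈ᶠ y → ρ x ≡ ρ y
  ρ-cong {bot}      {bot}      _          = refl
  ρ-cong {face _ _} {face _ _} (refl , _) = refl

  ρ-mono : ∀ {x y} → x ≤ᶠ y → ρ x ≤ ρ y
  ρ-mono {bot}                  _         = z≤n
  ρ-mono {face _ _} {face _ _} (C⊆D , _) = s≤s (p⊆q⇒∣p∣≤∣q∣ C⊆D)

  ρ-strict : ∀ {x y} → x <ᶠ y → ρ x < ρ y
  ρ-strict {bot}      {bot}      (_ , x≉y)         = ⊥-elim (x≉y _)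
  ρ-strict {bot}      {face _ _} _                 = s≤s z≤n
  ρ-strict {face _ _} {face _ _} ((C⊆D , p) , x≉y) =
    s≤s (p⊆q∧p≢q⇒∣p∣<∣q∣ C⊆D λ { refl → x≉y (refl , p) })

  ρ-bounded : ∀ x → ρ x ≤ suc r
  ρ-bounded bot        = z≤n
  ρ-bounded (face C _) = s≤s (∣p∣≤n C)

  <-by-rank : ∀ {x y} → x ≤ᶠ y → ρ x < ρ y → x <ᶠ y
  <-by-rank x≤y ρx<ρy = x≤y , ℕ.<⇒≢ ρx<ρy ∘ ρ-cong

  interpolate : ∀ {x y} → x ≤ᶠ y → suc (suc (ρ x)) ≤ ρ y →
                ∃ λ z → x ≤ᶠ z × z ≤ᶠ y × ρ z ≡ suc (ρ x)
  interpolate {bot}      {face D w} _ _ = face ∅ w , _ , (⊥⊆ , here) , cong suc (∣⊥∣≡0 r)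
  interpolate {face C v} {face D w} (C⊆D , p) (s≤s gap)
    with c , c∈D , c∉C ← ∣p∣<∣q∣⇒∃[x∈q∖p] {p = C} (ℕ.<⇒≤ gap) =
    face (C ∪ ⁅ c ⁆) v , (p⊆p∪q _ , here) , (p∪⁅x⁆⊆q C⊆D c∈D , p) , cong suc (∣p∪⁅x⁆∣≡1+∣p∣ c∉C)

  vertexFigure≅booleanLattice : ∀ v → upSet (colorfulPoset G) (face ∅ v) ≅ booleanLattice r
  vertexFigure≅booleanLattice v = record
    { to        = λ { (face C _ , _) → C }
    ; from      = λ C → face C v , ⊥⊆ , here
    ; to-cong   = λ { {face _ _ , _} {face _ _ , _} (C≡D , _) → C≡D }
    ; from-cong = λ { refl → refl , here }
    ; to-from   = λ _ → refl
    ; from-to   = λ { (face _ _ , _ , p) → refl , p }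
    ; to-mono   = λ { {face _ _ , _} {face _ _ , _} (C⊆D , _) → C⊆D }
    ; from-mono = λ C⊆D → C⊆D , here
    }

  simple : Simple (colorfulPoset G) ρ r
  simple (face C v) ρ≡1 with refl ← ∣p∣≡0⇒p≡∅ {p = C} (ℕ.suc-injective ρ≡1) = vertexFigure≅booleanLattice v

  module _ (loopless : Loopless G) where

    no-loop : ∀ {v c} → ¬ edge G v v ≡ just c
    no-loop {v} e with () ← trans (sym (loopless v)) e

    adjacent⇒≉ : ∀ {v w c} → edge G v w ≡ just c → ¬ face ∅ v ≈ᶠ face ∅ w
    adjacent⇒≉ e (_ , p) with refl ← ∼⟨∅⟩⇒≡ p = no-loop e

  module _ (symmetric : Symmetric G) where

    ≈-sym : ∀ {x y} → x ≈ᶠ y → y ≈ᶠ x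
    ≈-sym {bot}      {bot}      _          = _
    ≈-sym {face _ _} {face _ _} (refl , p) = refl , ∼-sym symmetric p

    isPartialOrder : IsPartialOrder _≈ᶠ_ _≤ᶠ_
    isPartialOrder = record
      { isPreorder = record
        { isEquivalence = record { refl = ≈-refl ; sym = ≈-sym ; trans = ≈-trans }
        ; reflexive     = ≤-reflexive
        ; trans         = ≤-trans
        }
      ; antisym = ≤-antisym
      }

    module _ (loopless : Loopless G) (proper : ProperColoring G) where

      neighbour-unique : ∀ {v w w′ c} → edge G v w ≡ just c → edge G v w′ ≡ just c → w ≡ w′
      neighbour-unique = proj₂ proper _ _ _ _

      monochromatic-path : ∀ {u w w′ c} → edge G w w′ ≡ just c → u ∼⟨ ⁅ c ⁆ ⟩ w → u ≡ w ⊎ u ≡ w′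
      monochromatic-path e here = inj₁ refl
      monochromatic-path {c = c} e (step e′ c′∈ p)
        with refl ← x∈⁅y⁆⇒x≡y c c′∈
        with monochromatic-path e p
      ... | inj₁ refl = inj₂ (neighbour-unique (edge-sym symmetric e′) e)
      ... | inj₂ refl = inj₁ (neighbour-unique (edge-sym symmetric e′) (edge-sym symmetric e))

      Diamond : Face V r → Face V r → Set
      Diamond F H = Σ (Face V r) λ H₁ → Σ (Face V r) λ H₂ → ¬ (H₁ ≈ᶠ H₂)
        × (F <ᶠ H₁ × H₁ <ᶠ H × ρ H₁ ≡ suc (ρ F))
        × (F <ᶠ H₂ × H₂ <ᶠ H × ρ H₂ ≡ suc (ρ F))
        × (∀ K → F <ᶠ K → K <ᶠ H → ρ K ≡ suc (ρ F) → K ≈ᶠ H₁ ⊎ K ≈ᶠ H₂)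

      between : ∀ {F K H} → ρ H ≡ suc (suc (ρ F)) → F ≤ᶠ K → K ≤ᶠ H → ρ K ≡ suc (ρ F) →
                F <ᶠ K × K <ᶠ H × ρ K ≡ suc (ρ F)
      between {F} ρH F≤K K≤H ρK =
        <-by-rank F≤K (ℕ.≤-reflexive (sym ρK)) ,
        <-by-rank K≤H (ℕ.≤-reflexive (trans (cong suc ρK) (sym ρH))) , ρK

      diamond : ∀ F H → F <ᶠ H → ρ H ≡ suc (suc (ρ F)) → Diamond F H
      diamond bot bot (_ , F≉H) _ = ⊥-elim (F≉H _)
      diamond bot (face D w) _ ρH
        with a , refl ← ∣p∣≡1⇒p≡⁅x⁆ {p = D} (ℕ.suc-injective ρH)
        with w′ , e ← proj₁ proper w a =
        face ∅ w , face ∅ w′ , adjacent⇒≉ loopless e ,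
        between ρH tt (⊥⊆ , here) ρ∅ ,
        between ρH tt (⊥⊆ , step (edge-sym symmetric e) (x∈⁅x⁆ a) here) ρ∅ ,
        unique
        where
        ρ∅ : suc ∣ ∅ {r} ∣ ≡ 1
        ρ∅ = cong suc (∣⊥∣≡0 r)
        unique : ∀ K → bot <ᶠ K → K <ᶠ face ⁅ a ⁆ w → ρ K ≡ 1 → K ≈ᶠ face ∅ w ⊎ K ≈ᶠ face ∅ w′
        unique (face E u) _ ((_ , p) , _) ρK
          with refl ← ∣p∣≡0⇒p≡∅ {p = E} (ℕ.suc-injective ρK)
          with monochromatic-path e p
        ... | inj₁ refl = inj₁ (refl , here)
        ... | inj₂ refl = inj₂ (refl , here)
      diamond (face C v) (face D w) ((C⊆D , p) , _) ρH
        with a , a∈D , a∉C ← ∣p∣<∣q∣⇒∃[x∈q∖p] {p = C} {D}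
                               (ℕ.≤-trans (ℕ.n≤1+n _) (ℕ.≤-reflexive (sym (ℕ.suc-injective ρH))))
        with b , b∉C₁ , D≡ ← p⊆q∧∣q∣≡1+∣p∣⇒q≡p∪⁅x⁆ (p∪⁅x⁆⊆q C⊆D a∈D)
                               (trans (ℕ.suc-injective ρH) (cong suc (sym (∣p∪⁅x⁆∣≡1+∣p∣ a∉C)))) =
        H a , H b , (λ (C₁≡C₂ , _) → b∉C₁ (subst (b ∈_) (sym C₁≡C₂) (x∈p∪⁅x⁆ C b))) ,
        between ρH (F≤H a) (H≤ a a∈D) (ρ-H a∉C) ,
        between ρH (F≤H b) (H≤ b b∈D) (ρ-H (b∉C₁ ∘ p⊆p∪q _)) ,
        unique
        where
        H : Fin r → Face V r
        H x = face (C ∪ ⁅ x ⁆) v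
        F≤H : ∀ x → face C v ≤ᶠ H x
        F≤H x = p⊆p∪q _ , here
        b∈D : b ∈ D
        b∈D = subst (b ∈_) (sym D≡) (x∈p∪⁅x⁆ _ b)
        H≤ : ∀ x → x ∈ D → H x ≤ᶠ face D w
        H≤ x x∈D = p∪⁅x⁆⊆q C⊆D x∈D , p
        ρ-H : ∀ {x} → x ∉ C → ρ (H x) ≡ suc (ρ (face C v))
        ρ-H x∉C = cong suc (∣p∪⁅x⁆∣≡1+∣p∣ x∉C)
        unique : ∀ K → face C v <ᶠ K → K <ᶠ face D w → ρ K ≡ suc (ρ (face C v)) → K ≈ᶠ H a ⊎ K ≈ᶠ H b
        unique (face E u) ((C⊆E , q) , _) ((E⊆D , _) , _) ρK
          with x , x∉C , E≡ ← p⊆q∧∣q∣≡1+∣p∣⇒q≡p∪⁅x⁆ C⊆E (ℕ.suc-injective ρK)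
          with x∈p∪⁅y⁆⁻ (subst (x ∈_) D≡ (E⊆D (subst (x ∈_) (sym E≡) (x∈p∪⁅x⁆ C x))))
        ... | inj₂ refl = inj₂ (E≡ , ∼-sym symmetric q)
        ... | inj₁ x∈C₁ with x∈p∪⁅y⁆⁻ x∈C₁
        ...   | inj₁ x∈C = ⊥-elim (x∉C x∈C)
        ...   | inj₂ refl = inj₁ (E≡ , ∼-sym symmetric q)

      G≅skeleton : GraphIso (underlyingGraph G) (skeleton (colorfulPoset G) ρ)
      G≅skeleton = record
        { to = vertex ; from = base ; to-cong = λ { refl → refl , here } ; from-cong = base-cong
        ; to-from = vertex-base ; from-to = λ _ → refl ; adj-to = adj-to ; adj-from = adj-from }
        where
        Sk = skeleton (colorfulPoset G) ρ
        vertex : V → Vtx Sk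
        vertex v = face ∅ v , cong suc (∣⊥∣≡0 r)
        base : Vtx Sk → V
        base (face _ v , _) = v
        base-cong : ∀ {x y} → _≈ᵥ_ Sk x y → base x ≡ base y
        base-cong {face C _ , ρ≡1} {face _ _ , _} (refl , p)
          with refl ← ∣p∣≡0⇒p≡∅ {p = C} (ℕ.suc-injective ρ≡1) = ∼⟨∅⟩⇒≡ p
        vertex-base : ∀ x → _≈ᵥ_ Sk (vertex (base x)) x
        vertex-base (face C _ , ρ≡1) with refl ← ∣p∣≡0⇒p≡∅ {p = C} (ℕ.suc-injective ρ≡1) = refl , here
        adj-to : ∀ {v w} → Adjacent G v w → Adj Sk (vertex v) (vertex w)
        adj-to (c , e) = adjacent⇒≉ loopless e , face ⁅ c ⁆ _ , cong suc (∣⁅x⁆∣≡1 c) ,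
                         (⊥⊆ , here) , (⊥⊆ , step (edge-sym symmetric e) (x∈⁅x⁆ c) here)
        adj-from : ∀ {x y} → Adj Sk x y → Adjacent G (base x) (base y)
        adj-from {face C v , ρC} {face C′ w , ρC′} (x≉y , face D u , ρD , (_ , p) , (_ , q))
          with refl ← ∣p∣≡0⇒p≡∅ {p = C} (ℕ.suc-injective ρC)
          with refl ← ∣p∣≡0⇒p≡∅ {p = C′} (ℕ.suc-injective ρC′)
          with c , refl ← ∣p∣≡1⇒p≡⁅x⁆ {p = D} (ℕ.suc-injective ρD)
          with u′ , e ← proj₁ proper u c
          with monochromatic-path e p | monochromatic-path e q
        ... | inj₁ refl | inj₁ refl = ⊥-elim (x≉y ≈-refl)
        ... | inj₁ refl | inj₂ refl = c , e
        ... | inj₂ refl | inj₁ refl = c , edge-sym symmetric e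
        ... | inj₂ refl | inj₂ refl = ⊥-elim (x≉y ≈-refl)

-- Flags

module Flags {n r : ℕ} (G : ColoredGraph (Fin n) r) (symmetric : Symmetric G)
             (loopless : Loopless G) (connected : Connected G) where
  open Paths G
  open ColorfulPoset G
  open Reachability G using (reach?)

  P : RawPoset
  P = colorfulPoset G

  faceSetoid : Setoid _ _
  faceSetoid = record { isEquivalence = IsPartialOrder.isEquivalence (isPartialOrder symmetric) }

  open Membership faceSetoid using () renaming (_∈_ to _∈ₚ_)
  open Membershipₚ using (∈-resp-≈; ∈-resp-≋; ∈-applyUpTo⁻)
  open ListEquality faceSetoid using (_≋_; []; _∷_; ≋-refl; ≋-sym; ≋-trans)

  top : Face (Fin n) r
  top = face full (proj₁ connected)

  ≤-top : ∀ x → x ≤ᶠ top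
  ≤-top bot        = tt
  ≤-top (face _ w) = ⊆⊤ , proj₂ connected w _

  open GradedPoset P (isPartialOrder symmetric) ρ (suc r) ρ-mono ρ-strict bot top (λ _ → tt) ≤-top
                   refl (cong suc (∣⊤∣≡n r)) interpolate
    using (flag-ranks)

  flag-length : ∀ Φ → IsFlag P Φ → length Φ ≡ suc (suc r)
  flag-length Φ flag =
    trans (sym (List.length-map ρ Φ)) (trans (cong length (flag-ranks flag)) (List.length-iterate suc 0 _))

  _≈?_ : ∀ x y → Dec (x ≈ᶠ y)
  bot      ≈? bot      = yes tt
  bot      ≈? face _ _ = no λ ()
  face _ _ ≈? bot      = no λ ()
  face C v ≈? face D w with C ≟ₛ D
  ... | no C≢D = no (C≢D ∘ proj₁)
  ... | yes refl with reach? C v w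
  ...   | yes p = yes (refl , p)
  ...   | no ¬p = no (¬p ∘ proj₂)

  -- the flag F₋₁ < (chain 0, base) < … < (chain r, base); chain is irrelevant beyond r
  record StdFlag : Set where
    field
      base    : Fin n
      chain   : ℕ → Subset r
      chain-⊆ : ∀ {j} → j < r → chain j ⊆ chain (suc j)
      ∣chain∣ : ∀ {j} → j ≤ r → ∣ chain j ∣ ≡ j

  open StdFlag

  faceAt : StdFlag → ℕ → Face (Fin n) r
  faceAt F j = face (chain F j) (base F)

  faces : StdFlag → List (Face (Fin n) r)
  faces F = bot ∷ applyUpTo (faceAt F) (suc r)

  chain-0 : ∀ F → chain F 0 ≡ ∅
  chain-0 F = ∣p∣≡0⇒p≡∅ (∣chain∣ F z≤n)

  chain-r : ∀ F → chain F r ≡ full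
  chain-r F = ∣p∣≡n⇒p≡⊤ (∣chain∣ F ℕ.≤-refl)

  chain-mono : ∀ F {i j} → i ≤ j → j ≤ r → chain F i ⊆ chain F j
  chain-mono F {j = zero}  z≤n _   = ⊆-refl
  chain-mono F {j = suc j} i≤j j<r with ℕ.m≤n⇒m<n∨m≡n i≤j
  ... | inj₂ refl      = ⊆-refl
  ... | inj₁ (s≤s i≤j) = ⊆-trans (chain-mono F i≤j (ℕ.<⇒≤ j<r)) (chain-⊆ F j<r)

  faceAt-index : ∀ F F′ {i j} → i ≤ r → j ≤ r → faceAt F i ≈ᶠ faceAt F′ j → i ≡ j
  faceAt-index F F′ i≤r j≤r (C≡D , _) = trans (sym (∣chain∣ F i≤r)) (trans (cong ∣_∣ C≡D) (∣chain∣ F′ j≤r))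

  ∈-faces⁻ : ∀ F {x} → x ∈ₚ faces F → x ≈ᶠ bot ⊎ ∃ λ j → j ≤ r × x ≈ᶠ faceAt F j
  ∈-faces⁻ F (here x≈bot) = inj₁ x≈bot
  ∈-faces⁻ F (there x∈)   with j , s≤s j≤r , x≈ ← ∈-applyUpTo⁻ faceSetoid (faceAt F) x∈ =
    inj₂ (j , j≤r , x≈)

  ∈-faces⁺ : ∀ F {x j} → j ≤ r → x ≈ᶠ faceAt F j → x ∈ₚ faces F
  ∈-faces⁺ F j≤r x≈ = there (Any.applyUpTo⁺ (faceAt F) x≈ (s≤s j≤r))

  faceAt∈faces : ∀ F′ F {k} → k ≤ r → faceAt F′ k ∈ₚ faces F → faceAt F′ k ≈ᶠ faceAt F k
  faceAt∈faces F′ F k≤r x∈ with ∈-faces⁻ F x∈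
  ... | inj₂ (j , j≤r , x≈) with refl ← faceAt-index F′ F k≤r j≤r x≈ = x≈

  faces-isFlag : ∀ F → IsFlag P (faces F)
  faces-isFlag F =
    (<-by-rank {y = faceAt F 0} tt (s≤s z≤n) ∷ applyUpTo⁺₁ (faceAt F) (suc r) consecutive) , maximal
    where
    consecutive : ∀ {j} → suc j < suc r → faceAt F j <ᶠ faceAt F (suc j)
    consecutive (s≤s j<r) = <-by-rank (chain-⊆ F j<r , here)
      (s≤s (ℕ.≤-reflexive (trans (cong suc (∣chain∣ F (ℕ.<⇒≤ j<r))) (sym (∣chain∣ F j<r)))))
    -- a face comparable with the level of its own rank is that level
    maximal : ∀ x → (∀ y → y ∈ₚ faces F → x ≤ᶠ y ⊎ y ≤ᶠ x) → x ∈ₚ faces F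
    maximal bot        _          = here tt
    maximal (face C u) comparable
      with ∣C∣≤r ← ∣p∣≤n C
      with ∣D∣ ← ∣chain∣ F ∣C∣≤r
      with comparable (faceAt F ∣ C ∣) (∈-faces⁺ F ∣C∣≤r ≈-refl)
    ... | inj₁ (C⊆D , p) with C≡D ← p⊆q∧∣p∣≡∣q∣⇒p≡q C⊆D (sym ∣D∣) =
      ∈-faces⁺ F ∣C∣≤r (C≡D , subst (u ∼⟨_⟩ base F) (sym C≡D) p)
    ... | inj₂ (D⊆C , p) with D≡C ← p⊆q∧∣p∣≡∣q∣⇒p≡q D⊆C ∣D∣ =
      ∈-faces⁺ F ∣C∣≤r (sym D≡C , ∼-sym symmetric p)

  setOf : Face (Fin n) r → Subset r
  setOf bot        = ∅
  setOf (face C _) = C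

  setOf-mono : ∀ {x y} → x ≤ᶠ y → setOf x ⊆ setOf y
  setOf-mono {bot}                 _         = ⊥⊆
  setOf-mono {face _ _} {face _ _} (C⊆D , _) = C⊆D

  chainOf : List (Face (Fin n) r) → ℕ → Subset r
  chainOf []       _       = ∅
  chainOf (x ∷ _)  zero    = setOf x
  chainOf (_ ∷ xs) (suc j) = chainOf xs j

  ∣chainOf∣ : ∀ L a {m} → map ρ L ≡ iterate suc (suc a) m → ∀ {j} → j < m → ∣ chainOf L j ∣ ≡ a + j
  ∣chainOf∣ (bot      ∷ L) a {suc m} eq {zero}  _ with () ← List.∷-injectiveˡ eq
  ∣chainOf∣ (face C _ ∷ L) a {suc m} eq {zero}  _ =
    trans (ℕ.suc-injective (List.∷-injectiveˡ eq)) (sym (ℕ.+-identityʳ a))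
  ∣chainOf∣ (_        ∷ L) a {suc m} eq {suc j} (s≤s j<m) =
    trans (∣chainOf∣ L (suc a) (List.∷-injectiveʳ eq) j<m) (sym (ℕ.+-suc a j))

  chainOf-⊆ : ∀ {L} → Linked _≤ᶠ_ L → ∀ {j} → suc j < length L → chainOf L j ⊆ chainOf L (suc j)
  chainOf-⊆ (x≤y ∷ _)  {zero}  _           = setOf-mono x≤y
  chainOf-⊆ (_   ∷ lk) {suc j} (s≤s 1+j<) = chainOf-⊆ lk 1+j<
  chainOf-⊆ [-]        {zero}  (s≤s ())
  chainOf-⊆ [-]        {suc j} (s≤s ())

  chainOf-≋ : ∀ {u L} → All (face ∅ u ≤ᶠ_) L → L ≋ applyUpTo (λ j → face (chainOf L j) u) (length L)
  chainOf-≋ {L = []}           All.[]              = []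
  chainOf-≋ {L = face C v ∷ L} ((_ , p) All.∷ all) = (refl , ∼-sym symmetric p) ∷ chainOf-≋ all

  parse : ∀ {Φ} → IsFlag P Φ → Σ StdFlag λ F → Φ ≋ faces F
  parse {Φ} flag with flag-ranks flag
  parse {[]}                      _ | ()
  parse {face _ _ ∷ _}            _ | ()
  parse {bot ∷ []}                _ | ()
  parse {bot ∷ bot ∷ _}           _ | ()
  parse {bot ∷ Φ′@(face C u ∷ _)} (_ ∷ lk , _) | eq =
    F , tt ∷ subst (λ m → Φ′ ≋ applyUpTo (faceAt F) m) length≡ Φ′≋
    where
    ranks : map ρ Φ′ ≡ iterate suc 1 (suc r)
    ranks = List.∷-injectiveʳ eq
    length≡ : length Φ′ ≡ suc r
    length≡ = trans (sym (List.length-map ρ Φ′))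
                    (trans (cong length ranks) (List.length-iterate suc 1 (suc r)))
    ≤-chain : Linked _≤ᶠ_ Φ′
    ≤-chain = Linked.map proj₁ lk
    F : StdFlag
    F = record
      { base    = u
      ; chain   = chainOf Φ′
      ; chain-⊆ = λ {j} j<r → chainOf-⊆ ≤-chain (subst (suc j <_) (sym length≡) (s≤s j<r))
      ; ∣chain∣ = λ j≤r → ∣chainOf∣ Φ′ 0 ranks (s≤s j≤r)
      }
    Φ′≋ : Φ′ ≋ applyUpTo (faceAt F) (length Φ′)
    Φ′≋ = chainOf-≋ (Linked⇒All ≤-trans ∅-below ≤-chain)
      where ∅-below : face ∅ u ≤ᶠ face C u
            ∅-below = ⊥⊆ , here

  record Move (F F′ : StdFlag) : Set where
    field
      index   : ℕ
      index≤r : index ≤ r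
      others  : ∀ {j} → j ≤ r → j ≢ index → faceAt F j ≈ᶠ faceAt F′ j
      changed : ¬ faceAt F index ≈ᶠ faceAt F′ index

  move-sym : ∀ {F F′} → Move F F′ → Move F′ F
  move-sym m = record
    { index = index ; index≤r = index≤r
    ; others = λ j≤r j≢k → ≈-sym symmetric (others j≤r j≢k) ; changed = changed ∘ ≈-sym symmetric }
    where open Move m

  move-oneOutside : ∀ {F F′} → Move F F′ → OneOutside P (faces F) (faces F′)
  move-oneOutside {F} {F′} m =
    faceAt F index , ∈-faces⁺ F index≤r ≈-refl , changed ∘ faceAt∈faces F F′ index≤r , only
    where
    open Move m
    only : ∀ y → y ∈ₚ faces F → ¬ y ∈ₚ faces F′ → y ≈ᶠ faceAt F index
    only y y∈ y∉ with ∈-faces⁻ F y∈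
    ... | inj₁ y≈bot = ⊥-elim (y∉ (here y≈bot))
    ... | inj₂ (j , j≤r , y≈) with j ℕ.≟ index
    ...   | yes refl = y≈
    ...   | no j≢k   = ⊥-elim (y∉ (∈-faces⁺ F′ j≤r (≈-trans y≈ (others j≤r j≢k))))

  move-adjacent : ∀ {F F′} → Move F F′ → AdjacentFlags P (faces F) (faces F′)
  move-adjacent m = move-oneOutside m , move-oneOutside (move-sym m)

  move-keeps : ∀ {K : Face (Fin n) r → Set} {F F′} (m : Move F F′) → (∀ {x y} → x ≈ᶠ y → K x → K y) →
               ¬ K (faceAt F (Move.index m)) → (∀ x → K x → x ∈ₚ faces F) → ∀ x → K x → x ∈ₚ faces F′
  move-keeps {F = F} {F′} m K-resp ¬K K⊆F x Kx with ∈-faces⁻ F (K⊆F x Kx)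
  ... | inj₁ x≈bot = here x≈bot
  ... | inj₂ (j , j≤r , x≈) with j ℕ.≟ Move.index m
  ...   | yes refl = ⊥-elim (¬K (K-resp x≈ Kx))
  ...   | no j≢k   = ∈-faces⁺ F′ j≤r (≈-trans x≈ (Move.others m j≤r j≢k))

  data Walk (K : Face (Fin n) r → Set) : StdFlag → StdFlag → Set where
    []  : ∀ {F} → Walk K F F
    _∷_ : ∀ {F F′ F″} → (Σ (Move F F′) λ m → ¬ K (faceAt F (Move.index m))) → Walk K F′ F″ → Walk K F F″

  _++ʷ_ : ∀ {K F F′ F″} → Walk K F F′ → Walk K F′ F″ → Walk K F F″
  []       ++ʷ w′ = w′
  (m ∷ w) ++ʷ w′ = m ∷ (w ++ʷ w′)

  oneOutside-resp-≋ : ∀ {Φ Φ′ Ψ Ψ′} → Φ ≋ Φ′ → Ψ ≋ Ψ′ → OneOutside P Φ′ Ψ′ → OneOutside P Φ Ψ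
  oneOutside-resp-≋ Φ≋ Ψ≋ (x , x∈ , x∉ , only) =
    x , ∈-resp-≋ faceSetoid (≋-sym Φ≋) x∈ , x∉ ∘ ∈-resp-≋ faceSetoid Ψ≋ ,
    λ y y∈ y∉ → only y (∈-resp-≋ faceSetoid Φ≋ y∈) (y∉ ∘ ∈-resp-≋ faceSetoid (≋-sym Ψ≋))

  walk⇒path : ∀ {K F F′ Φ Ψ} → (∀ {x y} → x ≈ᶠ y → K x → K y) → Walk K F F′ →
              Φ ≋ faces F → (∀ x → K x → x ∈ₚ Φ) → faces F′ ≋ Ψ → FlagPath P K Φ Ψ
  walk⇒path K-resp []             Φ≋ _   F′≋ = done (≋-trans Φ≋ F′≋)
  walk⇒path K-resp (_∷_ {F′ = F₁} (m , ¬K) w) Φ≋ K⊆Φ F′≋ =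
    step (faces-isFlag F₁)
         (oneOutside-resp-≋ Φ≋ ≋-refl (proj₁ (move-adjacent m)) ,
          oneOutside-resp-≋ ≋-refl Φ≋ (proj₂ (move-adjacent m)))
         K⊆
         (walk⇒path K-resp w ≋-refl K⊆ F′≋)
    where
    K⊆ : ∀ x → _ → x ∈ₚ faces F₁
    K⊆ = move-keeps m K-resp ¬K (λ x Kx → ∈-resp-≋ faceSetoid Φ≋ (K⊆Φ x Kx))

  -- swap the colours entering the chain at levels 1+s and 2+s, the latter being d
  module Swap (F : StdFlag) {s : ℕ} {d : Fin r} (1+s<r : suc s < r)
              (d∈ : d ∈ chain F (suc (suc s))) (d∉ : d ∉ chain F (suc s)) where

    new : Subset r
    new = chain F s ∪ ⁅ d ⁆

    d∉chain-s : d ∉ chain F s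
    d∉chain-s = d∉ ∘ chain-⊆ F (ℕ.<⇒≤ 1+s<r)

    chain′ : ℕ → Subset r
    chain′ j with j ℕ.≟ suc s
    ... | yes _ = new
    ... | no  _ = chain F j

    chain′-here : chain′ (suc s) ≡ new
    chain′-here with suc s ℕ.≟ suc s
    ... | yes _   = refl
    ... | no  s≢s = ⊥-elim (s≢s refl)

    chain′-elsewhere : ∀ {j} → j ≢ suc s → chain′ j ≡ chain F j
    chain′-elsewhere {j} j≢ with j ℕ.≟ suc s
    ... | yes j≡ = ⊥-elim (j≢ j≡)
    ... | no  _  = refl

    flag : StdFlag
    flag = record { base = base F ; chain = chain′ ; chain-⊆ = chain′-⊆ ; ∣chain∣ = ∣chain′∣ }
      where
      chain′-⊆ : ∀ {j} → j < r → chain′ j ⊆ chain′ (suc j)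
      chain′-⊆ {j} j<r with j ℕ.≟ suc s | suc j ℕ.≟ suc s
      ... | yes refl | yes 2+s≡1+s = ⊥-elim (ℕ.<-irrefl (sym 2+s≡1+s) ℕ.≤-refl)
      ... | yes refl | no  _       = p∪⁅x⁆⊆q (chain-mono F (ℕ.m≤n⇒m≤1+n (ℕ.n≤1+n s)) j<r) d∈
      ... | no  _    | yes refl    = p⊆p∪q _
      ... | no  _    | no  _       = chain-⊆ F j<r
      ∣chain′∣ : ∀ {j} → j ≤ r → ∣ chain′ j ∣ ≡ j
      ∣chain′∣ {j} j≤r with j ℕ.≟ suc s
      ... | yes refl =
        trans (∣p∪⁅x⁆∣≡1+∣p∣ d∉chain-s) (cong suc (∣chain∣ F (ℕ.<⇒≤ (ℕ.<-trans (ℕ.n<1+n s) 1+s<r))))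
      ... | no  _    = ∣chain∣ F j≤r

    move : Move F flag
    move = record
      { index   = suc s
      ; index≤r = ℕ.<⇒≤ 1+s<r
      ; others  = λ _ j≢ → sym (chain′-elsewhere j≢) , here
      ; changed = λ (chain≡ , _) → d∉ (subst (d ∈_) (sym (trans chain≡ chain′-here)) (x∈p∪⁅x⁆ _ d))
      }

    d∈flag : d ∈ chain flag (suc s)
    d∈flag = subst (d ∈_) (sym chain′-here) (x∈p∪⁅x⁆ _ d)

  relocate : ∀ (F : StdFlag) {u c} → c ∈ chain F 1 → edge G (base F) u ≡ just c → Σ StdFlag (Move F)
  relocate F {u} {c} c∈ e = F′ , record
    { index = 0 ; index≤r = z≤n ; others = others
    ; changed = λ (_ , p) → adjacent⇒≉ loopless e (refl , subst (base F ∼⟨_⟩ u) (chain-0 F) p) }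
    where
    F′ : StdFlag
    F′ = record F { base = u }
    others : ∀ {j} → j ≤ r → j ≢ 0 → faceAt F j ≈ᶠ faceAt F′ j
    others {zero}  _   0≢0 = ⊥-elim (0≢0 refl)
    others {suc j} j<r _   = refl , step e (chain-mono F (s≤s z≤n) j<r c∈) here

  record Lowered (K : Face (Fin n) r → Set) (F : StdFlag) (d : Fin r) (q p : ℕ) : Set where
    field
      flag      : StdFlag
      walk      : Walk K F flag
      same-base : base flag ≡ base F
      d-lowered : d ∈ chain flag (suc q)
      kept      : ∀ {j} → j ≤ q ⊎ p < j → chain flag j ≡ chain F j

  -- bring d, which enters the chain at level 1+p, down to level 1+q by successive swaps
  lower : ∀ {K} F {d} q p → q ≤ p → p < r → d ∈ chain F (suc p) → d ∉ chain F p →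
          (∀ F′ {k} → q < k → k ≤ p → d ∉ chain F′ k → ¬ K (faceAt F′ k)) → Lowered K F d q p
  lower F q p q≤p p<r d∈ d∉ avoid with q ℕ.≟ p
  ... | yes refl = record { flag = F ; walk = [] ; same-base = refl ; d-lowered = d∈ ; kept = λ _ → refl }
  lower F .0 zero z≤n _ _ _ _ | no 0≢0 = ⊥-elim (0≢0 refl)
  lower {K} F {d} q (suc s) q≤1+s 1+s<r d∈ d∉ avoid | no q≢1+s = record
    { flag      = flag R
    ; walk      = (S.move , avoid F (ℕ.≤∧≢⇒< q≤1+s q≢1+s) ℕ.≤-refl d∉) ∷ walk R
    ; same-base = same-base R
    ; d-lowered = d-lowered R
    ; kept      = kept′
    }
    where
    module S = Swap F 1+s<r d∈ d∉
    open Lowered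
    s≢1+s : ∀ {j} → j ≤ s → j ≢ suc s
    s≢1+s j≤s refl = ℕ.<-irrefl refl j≤s
    R : Lowered K S.flag d q s
    R = lower S.flag q s (ℕ.≤-pred (ℕ.≤∧≢⇒< q≤1+s q≢1+s)) (ℕ.<-trans (ℕ.n<1+n s) 1+s<r) S.d∈flag
          (subst (d ∉_) (sym (S.chain′-elsewhere (s≢1+s ℕ.≤-refl))) S.d∉chain-s)
          (λ F′ q<k k≤s → avoid F′ q<k (ℕ.m≤n⇒m≤1+n k≤s))
    kept′ : ∀ {j} → j ≤ q ⊎ suc s < j → chain (flag R) j ≡ chain F j
    kept′ (inj₁ j≤q)   = trans (kept R (inj₁ j≤q))
                               (S.chain′-elsewhere (s≢1+s (ℕ.≤-trans j≤q (ℕ.≤-pred (ℕ.≤∧≢⇒< q≤1+s q≢1+s)))))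
    kept′ (inj₂ 1+s<j) = trans (kept R (inj₂ (ℕ.<-trans (ℕ.n<1+n s) 1+s<j)))
                               (S.chain′-elsewhere (λ { refl → ℕ.<-irrefl refl 1+s<j }))

  chain-step : ∀ F {j d} → j < r → d ∉ chain F j → d ∈ chain F (suc j) → chain F (suc j) ≡ chain F j ∪ ⁅ d ⁆
  chain-step F j<r d∉ d∈ = sym (p⊆q∧∣p∣≡∣q∣⇒p≡q (p∪⁅x⁆⊆q (chain-⊆ F j<r) d∈)
    (trans (∣p∪⁅x⁆∣≡1+∣p∣ d∉) (trans (cong suc (∣chain∣ F (ℕ.<⇒≤ j<r))) (sym (∣chain∣ F j<r)))))

  module _ {K : Face (Fin n) r → Set} {j₀ : ℕ} (j₀≤r : j₀ ≤ r)
           (below : ∀ F′ {k} → k < j₀ → ¬ K (faceAt F′ k)) where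

    -- follow an edge of colour c: lower c to level 1, then move the base vertex along the edge
    travel : ∀ F {C u} → chain F j₀ ≡ C → base F ∼⟨ C ⟩ u → Σ StdFlag λ F′ → Walk K F F′ × base F′ ≡ u
    travel F _ here = F , [] , refl
    travel F {C} chain≡ (step {u = x} {c = c} e c∈C p) =
      let i , _ , i<j₀ , c∉ , c∈ = crossing (λ j → c ∈? chain F j) z≤n
                                     (subst (c ∉_) (sym (chain-0 F)) ∉⊥) (subst (c ∈_) (sym chain≡) c∈C)
          L = lower F 0 i z≤n (ℕ.<-≤-trans i<j₀ j₀≤r) c∈ c∉ (λ F′ _ k≤i _ → below F′ (ℕ.≤-<-trans k≤i i<j₀))
          F₂ , m = relocate (flag L) (d-lowered L) (subst (λ v → edge G v x ≡ just c) (sym (same-base L)) e)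
          F₃ , w , base≡ = travel F₂ (trans (kept L (inj₂ i<j₀)) chain≡) p
      in F₃ , walk L ++ʷ ((m , below (flag L) (ℕ.≤-<-trans z≤n i<j₀)) ∷ w) , base≡
      where open Lowered

  applyUpTo-≋ : ∀ f g m → (∀ {j} → j < m → f j ≈ᶠ g j) → applyUpTo f m ≋ applyUpTo g m
  applyUpTo-≋ f g zero    _  = []
  applyUpTo-≋ f g (suc m) f≈g = f≈g (s≤s z≤n) ∷ applyUpTo-≋ (f ∘ suc) (g ∘ suc) m (f≈g ∘ s≤s)

  module _ {K : Face (Fin n) r → Set} (T : StdFlag)
           (off-target : ∀ F′ {k} → k ≤ r → ¬ faceAt F′ k ≈ᶠ faceAt T k → ¬ K (faceAt F′ k)) where

    -- make level 1+q of F agree with T by lowering the colour that T adds at that level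
    fix-level : ∀ {q} F → q < r → (∀ {j} → j ≤ q → chain F j ≡ chain T j) →
                Σ StdFlag λ F′ → Walk K F F′ × base F′ ≡ base F
                               × (∀ {j} → j ≤ suc q → chain F′ j ≡ chain T j)
    fix-level {q} F q<r agree = flag L , walk L , same-base L , agree′
      where
      open Lowered
      new = ∣p∣<∣q∣⇒∃[x∈q∖p] {p = chain T q} {chain T (suc q)}
              (ℕ.≤-reflexive (sym (trans (∣chain∣ T q<r) (cong suc (sym (∣chain∣ T (ℕ.<⇒≤ q<r)))))))
      d = proj₁ new
      d∈T = proj₁ (proj₂ new)
      d∉T = proj₂ (proj₂ new)
      entry = crossing (λ j → d ∈? chain F j) (ℕ.<⇒≤ q<r) (subst (d ∉_) (sym (agree ℕ.≤-refl)) d∉T)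
                       (subst (d ∈_) (sym (chain-r F)) ∈⊤)
      level = proj₁ entry
      avoid : ∀ F′ {k} → q < k → k ≤ level → d ∉ chain F′ k → ¬ K (faceAt F′ k)
      avoid F′ q<k k≤l d∉F′ = off-target F′ k≤r
        λ (chain≡ , _) → d∉F′ (subst (d ∈_) (sym chain≡) (chain-mono T q<k k≤r d∈T))
        where k≤r = ℕ.≤-trans k≤l (ℕ.<⇒≤ (proj₁ (proj₂ (proj₂ entry))))
      L : Lowered K F d q level
      L = let _ , q≤l , l<r , d∉ , d∈ = entry in lower F q level q≤l l<r d∈ d∉ avoid
      level-q : chain (flag L) q ≡ chain T q
      level-q = trans (kept L (inj₁ ℕ.≤-refl)) (agree ℕ.≤-refl)
      agree′ : ∀ {j} → j ≤ suc q → chain (flag L) j ≡ chain T j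
      agree′ {j} j≤1+q with ℕ.m≤n⇒m<n∨m≡n j≤1+q
      ... | inj₁ (s≤s j≤q) = trans (kept L (inj₁ j≤q)) (agree j≤q)
      ... | inj₂ refl      = begin
        chain (flag L) (suc q)
          ≡⟨ chain-step (flag L) q<r (subst (d ∉_) (sym level-q) d∉T) (d-lowered L) ⟩
        chain (flag L) q ∪ ⁅ d ⁆
          ≡⟨ cong (_∪ ⁅ d ⁆) level-q ⟩
        chain T q ∪ ⁅ d ⁆
          ≡⟨ chain-step T q<r d∉T d∈T ⟨
        chain T (suc q)
          ∎
        where open ≡-Reasoning

    sort : ∀ k q F → k + q ≡ r → base F ≡ base T → (∀ {j} → j ≤ q → chain F j ≡ chain T j) →
           Σ StdFlag λ F′ → Walk K F F′ × faces F′ ≋ faces T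
    sort zero .r F refl base≡ agree =
      F , [] , tt ∷ applyUpTo-≋ (faceAt F) (faceAt T) (suc r)
                      (λ {j} j<1+r → agree (ℕ.≤-pred j<1+r) , subst (base F ∼⟨ chain F j ⟩_) base≡ here)
    sort (suc k) q F k+q≡r base≡ agree =
      let F₁ , w₁ , base≡₁ , agree₁ = fix-level F (subst (q <_) k+q≡r (s≤s (ℕ.m≤n+m q k))) agree
          F₂ , w₂ , F₂≋T = sort k (suc q) F₁ (trans (ℕ.+-suc k q) k+q≡r) (trans base≡₁ base≡) agree₁
      in F₂ , w₁ ++ʷ w₂ , F₂≋T

  walk-map : ∀ {K K′ F F′} → (∀ x → K′ x → K x) → Walk K F F′ → Walk K′ F F′
  walk-map K′⊆K []             = []
  walk-map K′⊆K ((m , ¬K) ∷ w) = (m , ¬K ∘ K′⊆K _) ∷ walk-map K′⊆K w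

  connect : ∀ S T → Σ StdFlag λ F → Walk (λ x → x ∈ₚ faces S × x ∈ₚ faces T) S F × faces F ≋ faces T
  connect S T = F₂ , walkA ++ʷ walkB , F₂≋T
    where
    K : Face (Fin n) r → Set
    K x = x ∈ₚ faces S × x ∈ₚ faces T
    Common : ℕ → Set
    Common j = j ≤ r × faceAt S j ≈ᶠ faceAt T j
    common-r : Common r
    common-r = ℕ.≤-refl , trans (chain-r S) (sym (chain-r T))
                        , subst (base S ∼⟨_⟩ base T) (sym (chain-r S)) (proj₂ connected _ _)
    -- the faces shared by S and T lie at the levels where S and T agree, hence at level j₀ or above
    least-common = least (λ j → j ℕ.≤? r ×-dec faceAt S j ≈? faceAt T j) common-r
    j₀ = proj₁ least-common
    common-j₀ = proj₁ (proj₂ (proj₂ least-common))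
    below : ∀ F′ {k} → k < j₀ → ¬ K (faceAt F′ k)
    below F′ k<j₀ (∈S , ∈T) =
      let k≤r = ℕ.<⇒≤ (ℕ.<-≤-trans k<j₀ (proj₁ (proj₂ least-common)))
      in proj₂ (proj₂ (proj₂ least-common)) k<j₀
           (k≤r , ≈-trans (≈-sym symmetric (faceAt∈faces F′ S k≤r ∈S)) (faceAt∈faces F′ T k≤r ∈T))
    off-target : ∀ F′ {k} → k ≤ r → ¬ faceAt F′ k ≈ᶠ faceAt T k → ¬ K (faceAt F′ k)
    off-target F′ k≤r ≉T (_ , ∈T) = ≉T (faceAt∈faces F′ T k≤r ∈T)
    phaseA = travel (proj₁ common-j₀) below S refl (proj₂ (proj₂ common-j₀))
    F₁ = proj₁ phaseA
    walkA = proj₁ (proj₂ phaseA)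
    phaseB = sort T off-target r 0 F₁ (ℕ.+-identityʳ r) (proj₂ (proj₂ phaseA))
                  (λ { z≤n → trans (chain-0 F₁) (sym (chain-0 T)) })
    F₂ = proj₁ phaseB
    walkB = proj₁ (proj₂ phaseB)
    F₂≋T = proj₂ (proj₂ phaseB)

  strongly-flag-connected : ∀ Φ Ψ → IsFlag P Φ → IsFlag P Ψ → FlagPath P (λ x → x ∈ₚ Φ × x ∈ₚ Ψ) Φ Ψ
  strongly-flag-connected Φ Ψ flagΦ flagΨ =
    let S , Φ≋S = parse flagΦ
        T , Ψ≋T = parse flagΨ
        F , w , F≋T = connect S T
    in walk⇒path K-resp
         (walk-map (λ _ (∈Φ , ∈Ψ) → ∈-resp-≋ faceSetoid Φ≋S ∈Φ , ∈-resp-≋ faceSetoid Ψ≋T ∈Ψ) w)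
         Φ≋S (λ _ → proj₁) (≋-trans F≋T (≋-sym Ψ≋T))
    where
    K-resp : ∀ {x y} → x ≈ᶠ y → x ∈ₚ Φ × x ∈ₚ Ψ → y ∈ₚ Φ × y ∈ₚ Ψ
    K-resp x≈y (x∈Φ , x∈Ψ) = ∈-resp-≈ faceSetoid x≈y x∈Φ , ∈-resp-≈ faceSetoid x≈y x∈Ψ

isAbstractPolytope : ∀ {n r} (G : ColoredGraph (Fin n) r) →
  Symmetric G → Loopless G → ProperColoring G → Connected G →
  IsAbstractPolytope (colorfulPoset G) r (rankCP G)
isAbstractPolytope {r = r} G symmetric loopless proper connected = record
  { isPartialOrder          = isPartialOrder symmetric
  ; rank-cong               = ρ-cong
  ; rank-bounded            = ρ-bounded
  ; rank-onto               = rank-onto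
  ; rank-strict             = ρ-strict
  ; least                   = bot , λ _ → tt
  ; greatest                = top , ≤-top
  ; flag-length             = flag-length
  ; strongly-flag-connected = strongly-flag-connected
  ; diamond                 = diamond symmetric loopless proper
  }
  where
  open ColorfulPoset G
  open Flags G symmetric loopless connected
  rank-onto : ∀ j → j ≤ suc r → ∃ λ x → ρ x ≡ j
  rank-onto zero    _         = bot , refl
  rank-onto (suc j) (s≤s j≤r) = let C , ∣C∣ = ∃[∣p∣≡j] r j j≤r in face C (proj₁ connected) , cong suc ∣C∣

-- Facets

module Facets {n k : ℕ} (G : ColoredGraph (Fin n) (suc k)) (symmetric : Symmetric G) where
  open Paths G
  open Reachability G using (reach?)
  open ColorfulPoset G using (_≈ᶠ_)

  ∣∁⁅b⁆∣ : ∀ b → ∣ ∁ ⁅ b ⁆ ∣ ≡ k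
  ∣∁⁅b⁆∣ b = trans (∣∁p∣≡n∸∣p∣ ⁅ b ⁆) (cong (suc k ∸_) (∣⁅x⁆∣≡1 b))

  ∁-involutive : ∀ {m} (p : Subset m) → ∁ (∁ p) ≡ p
  ∁-involutive p = trans (sym (map-∘ not not p)) (trans (map-cong Bool.not-involutive p) (map-id p))

  facetOf : Fin (suc k) × Fin n → Facet G
  facetOf (b , v) = face (∁ ⁅ b ⁆) v , cong suc (∣∁⁅b⁆∣ b)

  facetBijection : FacetBijection G
  facetBijection = record
    { to      = facetOf
    ; to-cong = λ { (refl , p) → refl , p }
    ; to-inj  = λ { {b , _} {b′ , _} (∁b≡∁b′ , p) →
                    x∈⁅y⁆⇒x≡y b′ (subst (b ∈_) (∁-injective ∁b≡∁b′) (x∈⁅x⁆ b)) , p }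
    ; to-surj = surj
    }
    where
    ∁-injective : ∀ {p q : Subset (suc k)} → ∁ p ≡ ∁ q → p ≡ q
    ∁-injective {p} {q} eq = trans (sym (∁-involutive p)) (trans (cong ∁ eq) (∁-involutive q))
    surj : ∀ (F : Facet G) → ∃ λ x → proj₁ (facetOf x) ≈ᶠ proj₁ F
    surj (face C w , ρ≡) with b , ∁C≡ ← ∣p∣≡1⇒p≡⁅x⁆ {p = ∁ C}
      (trans (∣∁p∣≡n∸∣p∣ C) (trans (cong (suc k ∸_) (ℕ.suc-injective ρ≡)) (ℕ.m+n∸n≡m 1 k)))
      = (b , w) , trans (cong ∁ (sym ∁C≡)) (∁-involutive C) , here

  module _ (b : Fin (suc k)) (v : Fin n) where
    private
      H = componentGraph G b v
      B = ∁ ⁅ b ⁆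

    b∉ : ∀ {c} → c ∈ B → b ≢ c
    b∉ c∈B refl = x∈∁p⇒x∉p c∈B (x∈⁅x⁆ b)

    dropColor-kept : ∀ {c} → b ≢ c → ∃ λ c′ → dropColor b (just c) ≡ just c′ × punchIn b c′ ≡ c
    dropColor-kept {c} b≢c with b Fin.≟ c
    ... | yes b≡c = ⊥-elim (b≢c b≡c)
    ... | no  b≢c = punchOut b≢c , refl , Fin.punchIn-punchOut b≢c

    dropColor⁻ : ∀ {mc c′} → dropColor b mc ≡ just c′ → ∃ λ c → mc ≡ just c × punchIn b c′ ≡ c
    dropColor⁻ {just c} e with b Fin.≟ c
    dropColor⁻ {just c} refl | no b≢c = c , refl , Fin.punchIn-punchOut b≢c

    path⇒component-path : ∀ {C x y} → C ⊆ B → x ∼⟨ B ⟩ v → x ∼⟨ C ⟩ y → ∀ .{x∼ y∼} →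
                          _∼[_]_ H ⟨ x , x∼ ⟩ (removeAt C b) ⟨ y , y∼ ⟩
    path⇒component-path C⊆B x∼v here = here
    path⇒component-path C⊆B x∼v (step e c∈ p) =
      let c′ , dropped , c′↑ = dropColor-kept (b∉ (C⊆B c∈))
          u∼v = step (edge-sym symmetric e) (C⊆B c∈) x∼v
      in step {u = ⟨ _ , u∼v ⟩} (trans (cong (dropColor b) e) dropped)
              (∈-removeAt⁺ b (subst (_∈ _) (sym c′↑) c∈)) (path⇒component-path C⊆B u∼v p)

    component-path⇒path : ∀ {D X Y} → _∼[_]_ H X D Y →
                          Component.vertex X ∼⟨ insertAt D b outside ⟩ Component.vertex Y
    component-path⇒path here = here
    component-path⇒path (step e c′∈ p) with c , e′ , refl ← dropColor⁻ e =
      step e′ (∈-insertAt⁺ b c′∈) (component-path⇒path p)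

    insertAt⊆∁⁅b⁆ : ∀ D → insertAt D b outside ⊆ B
    insertAt⊆∁⁅b⁆ D x∈ with c , refl , _ ← ∈-insertAt⁻ b {D} x∈ =
      x∉p⇒x∈∁p (Fin.punchInᵢ≢i b c ∘ x∈⁅y⁆⇒x≡y b)

    insertAt-removeAt-∁⁅b⁆ : ∀ {C} → C ⊆ B → insertAt (removeAt C b) b outside ≡ C
    insertAt-removeAt-∁⁅b⁆ {C} C⊆B with lookup C b in eq
    ... | outside = trans (cong (insertAt (removeAt C b) b) (sym eq)) (insertAt-removeAt C b)
    ... | inside  = ⊥-elim (b∉ (C⊆B (lookup⇒[]= b C eq)) refl)

    facet≅componentPoset : downSet (colorfulPoset G) (face B v) ≅ colorfulPoset H
    facet≅componentPoset = record
      { to        = to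
      ; from      = from
      ; to-cong   = to-cong
      ; from-cong = from-cong
      ; to-from   = λ { bot → tt ; (face D _) → removeAt-insertAt D b outside , here }
      ; from-to   = λ { (bot , _) → tt ; (face C _ , C⊆B , _) → insertAt-removeAt-∁⁅b⁆ C⊆B , here }
      ; to-mono   = to-mono
      ; from-mono = from-mono
      }
      where
      Dn = downSet (colorfulPoset G) (face B v)
      to : Carrier Dn → Face (Component G b v) k
      to (bot , _)            = bot
      to (face C w , _ , w∼v) = face (removeAt C b) ⟨ w , w∼v ⟩
      from : Face (Component G b v) k → Carrier Dn
      from bot                  = bot , tt
      -- the path w∼v stored in a component vertex is irrelevant, but can be recomputed
      from (face D ⟨ w , w∼v ⟩) =
        face (insertAt D b outside) w , insertAt⊆∁⁅b⁆ D , recompute (reach? B w v) w∼v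
      to-cong : ∀ {x y} → Eq Dn x y → _≈F_ H (to x) (to y)
      to-cong {bot , _}              {bot , _}      _          = tt
      to-cong {face _ _ , C⊆B , w∼v} {face _ _ , _} (refl , p) = refl , path⇒component-path C⊆B w∼v p
      from-cong : ∀ {x y} → _≈F_ H x y → Eq Dn (from x) (from y)
      from-cong {bot}      {bot}      _          = tt
      from-cong {face _ _} {face _ _} (refl , p) = refl , component-path⇒path p
      to-mono : ∀ {x y} → Le Dn x y → _≤F_ H (to x) (to y)
      to-mono {bot , _}                                   _         = tt
      to-mono {face _ _ , _ , w∼v} {face _ _ , D⊆B , _} (C⊆D , p) =
        (λ c∈ → ∈-removeAt⁺ b (C⊆D (∈-removeAt⁻ b c∈))) , path⇒component-path D⊆B w∼v p
      from-mono : ∀ {x y} → _≤F_ H x y → Le Dn (from x) (from y)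
      from-mono {bot}                 _         = tt
      from-mono {face _ _} {face _ _} (C⊆D , p) =
        (λ x∈ → let c , c↑ , c∈ = ∈-insertAt⁻ b x∈ in subst (_∈ _) c↑ (∈-insertAt⁺ b (C⊆D c∈))) ,
        component-path⇒path p

facets : ∀ {n r} (G : ColoredGraph (Fin n) r) → Symmetric G → 1 ≤ r →
  Σ (FacetBijection G) λ φ →
    ∀ b v → downSet (colorfulPoset G) (proj₁ (FacetBijection.to φ (b , v)))
              ≅ colorfulPoset (componentGraph G b v)
facets {r = suc k} G symmetric _ = facetBijection , facet≅componentPoset
  where open Facets G symmetric

mainTheorem2 :
    ∀ (n r : ℕ) (G : ColoredGraph (Fin n) r) →
    Symmetric G → Loopless G → ProperColoring G → Connected G →
    IsAbstractPolytope (colorfulPoset G) r (rankCP G)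
    × Simple (colorfulPoset G) (rankCP G) r
    × GraphIso (underlyingGraph G) (skeleton (colorfulPoset G) (rankCP G))
    × (1 ≤ r →
        Σ (FacetBijection G) λ φ →
          ∀ b v → downSet (colorfulPoset G) (proj₁ (FacetBijection.to φ (b , v)))
                    ≅ colorfulPoset (componentGraph G b v))
mainTheorem2 n r G symmetric loopless proper connected =
  isAbstractPolytope G symmetric loopless proper connected ,
  ColorfulPoset.simple G ,
  ColorfulPoset.G≅skeleton G symmetric loopless proper ,
  facets G symmetric
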